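{- Let $a,b,v,z$ be distinct alternatives and let $\mathcal D\subseteq\mathcal L(\{a,b,v,z\})$ be a peak-pit Condorcet domain with $abvz\in\mathcal D$ and $vzba\in\mathcal D$ such that $N_p(\mathcal D_{\{a,b,z\}})=\{bN_{\{a,b,z\}}1\}$. Then $N_p(\mathcal D_{\{a,b,v\}})=\{bN_{\{a,b,v\}}1\}$. Consequently, if $\mathcal G=(G_1,\dots,G_k)$ is a geodesic on $\mathcal L(\{a,b,v\})$ connecting $abv$ and $vba$ such that $\mathcal D_{\{a,b,v\}}\cup\{G_1,\dots,G_k\}$ is a peak-pit Condorcet domain, then the sequence of switching pairs of $\mathcal G$ is $(b,v),(a,v),(a,b)$ in this order.
   Context: Linear orders are written as words from top to bottom; $\mathcal D_B$ is the set of restrictions of orders of $\mathcal D$ to $B$. For distinct $p,q,r$, $x\in\{p,q,r\}$, $k\in\{1,2,3\}$, a domain satisfies the never-condition $xN_{\{p,q,r\}}k$ if none of its orders restricted to $\{p,q,r\}$ has $x$ in position $k$; the ones with $k=1$ (never-top) or $k=3$ (never-bottom) are peak-pit conditions, and $N_p(\cdot)$ is the set of peak-pit conditions a domain satisfies. A domain is a peak-pit Condorcet domain if for every triple of distinct alternatives it satisfies at least one peak-pit condition. Two orders are alike if they differ by a swap of two adjacent alternatives $x,y$ (their switching pair $(x,y)$); a geodesic is a path of alike orders of minimum length between its endpoints. -}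

module Defs where

open import Data.Nat using (ℕ; zero; suc; _≤_)
open import Data.List using (List; []; _∷_; _++_; filter; length; head; last)
open import Data.Maybe using (Maybe; just; nothing)
open import Data.Product using (Σ; ∃; _×_; _,_)
open import Data.Sum using (_⊎_)
open import Relation.Binary.Definitions using (DecidableEquality)
open import Relation.Binary.PropositionalEquality using (_≡_; _≢_)
open import Relation.Nullary using (¬_)
open import Data.List.Relation.Binary.Permutation.Propositional using (_↭_)
import Data.List.Membership.DecPropositional as DecMem
open import Data.List.Membership.Propositional using (_∈_)

-- A linear order on a finite set of alternatives is written as a list,
-- from top to bottom.
Order : Set → Set
Order X = List X

Domain : Set → Set₁
Domain X = Order X → Set

at : {X : Set} → List X → ℕ → Maybe X
at []       _       = nothing
at (x ∷ _)  zero    = just x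
at (_ ∷ xs) (suc i) = at xs i

-- Peak-pit positions: never-top (k = 1) and never-bottom (k = 3).
data PeakPit : Set where
  top bottom : PeakPit

ppIndex : PeakPit → ℕ
ppIndex top    = 0
ppIndex bottom = 2

IsLinOrd : {X : Set} → List X → Order X → Set
IsLinOrd S o = o ↭ S

Alike : {X : Set} → Order X → Order X → X → X → Set
Alike {X} o o' x y = Σ (List X) λ l → Σ (List X) λ r →
  (o ≡ l ++ (x ∷ y ∷ r)) × (o' ≡ l ++ (y ∷ x ∷ r))

data AlikePath {X : Set} : List (Order X) → List (X × X) → Set where
  single : (o : Order X) → AlikePath (o ∷ []) []
  step   : {o o' : Order X} {os : List (Order X)} {x y : X} {ps : List (X × X)} →
           Alike o o' x y → AlikePath (o' ∷ os) ps →
           AlikePath (o ∷ o' ∷ os) ((x , y) ∷ ps)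

PathIn : {X : Set} → List X → Order X → Order X → List (Order X) → Set
PathIn {X} S s t G =
  (∃ λ ps → AlikePath G ps) ×
  ((o : Order X) → o ∈ G → IsLinOrd S o) ×
  (head G ≡ just s) × (last G ≡ just t)

Geodesic : {X : Set} → List X → Order X → Order X → List (Order X) → Set
Geodesic {X} S s t G =
  PathIn S s t G × ((G' : List (Order X)) → PathIn S s t G' → length G ≤ length G')

module _ {X : Set} (_≟_ : DecidableEquality X) where
  open DecMem _≟_ using (_∈?_)

  restrict : List X → Order X → Order X
  restrict B o = filter (λ x → x ∈? B) o

  Restr : List X → Domain X → Domain X
  Restr B D o = ∃ λ o' → D o' × (o ≡ restrict B o')

  Never : Domain X → List X → X → PeakPit → Set
  Never D T x k = (o : Order X) → D o → ¬ (at (restrict T o) (ppIndex k) ≡ just x)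

  PeakPitCD : List X → Domain X → Set
  PeakPitCD S D =
    (p q r : X) → p ∈ S → q ∈ S → r ∈ S → p ≢ q → p ≢ r → q ≢ r →
    ∃ λ x → ∃ λ k → x ∈ (p ∷ q ∷ r ∷ []) × Never D (p ∷ q ∷ r ∷ []) x k

  NpIsSingleton : Domain X → List X → X → PeakPit → Set
  NpIsSingleton D T y c =
    Never D T y c × ((x : X) (k : PeakPit) → x ∈ T → Never D T x k → (x ≡ y) × (k ≡ c))

module Submission where

-- On {a, b, v} the orders abv and vba of D leave only b N 1 and b N 3 as possible peak-pit
-- conditions.  On {b, v, z} the orders bvz and vzb leave only v N 3 and z N 1, and both forbid
-- zbv, so no order of D restricts to zbv.  An order with b on top of {a, b, v} but not on top
-- of {a, b, z} would restrict to zbv, hence b N 1 holds on {a, b, v}; likewise b N 3 on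
-- {a, b, v} would give b N 3 on {a, b, z}, which N_p(D_{abz}) = {b N 1} excludes.
-- The only two geodesics from abv to vba are abv bav bva vba and abv avb vab vba; adding the
-- first to D_{abv} violates every peak-pit condition on {a, b, v}, since b N 3 already fails.
-- Facts about single orders are decided after transporting along the injection
-- lookup (a ∷ b ∷ v ∷ z ∷ []) : Fin 4 → X, where restriction computes.

open import Defs
open import Data.Empty using (⊥-elim)
open import Data.Fin using (Fin; #_)
import Data.Fin as Fin
open import Data.Fin.Properties using (all?)
open import Data.List using (List; []; _∷_; map; lookup; allFin; length; head; last)
open import Data.List.Membership.Propositional using (_∈_)
open import Data.List.Membership.Propositional.Properties using (∈-map⁺; ∈-map⁻; ∈-lookup; ∈-allFin)
import Data.List.Membership.DecPropositional as DecMembership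
open import Data.List.Properties using (filter-idem; filter-accept; filter-reject; ∷-injectiveˡ; ∷-injectiveʳ)
import Data.List.Properties as List
open import Data.List.Relation.Binary.Permutation.Propositional using (_↭_; ↭-sym; ↭-refl; ↭-trans; prep; swap)
open import Data.List.Relation.Binary.Permutation.Propositional.Properties
  using (↭-map-inv; ∈-resp-↭; ↭-length; ↭-reverse)
open import Data.List.Relation.Unary.All as All using ([]; _∷_)
open import Data.List.Relation.Unary.AllPairs using ([]; _∷_)
open import Data.List.Relation.Unary.Any using (here; there)
open import Data.List.Relation.Unary.Unique.Propositional using (Unique)
open import Data.Maybe using (just)
import Data.Maybe as Maybe
open import Data.Maybe.Properties using (just-injective)
import Data.Maybe.Properties as Maybe
open import Data.Nat using (zero; suc; _≤_; s≤s)
open import Data.Product using (_×_; _,_; ∃; proj₁; proj₂)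
open import Data.Sum using (_⊎_; inj₁; inj₂)
open import Function using (_∘_)
open import Function.Definitions using (Injective)
open import Relation.Binary.Definitions using (DecidableEquality)
open import Relation.Binary.PropositionalEquality using (_≡_; _≢_; refl; sym; trans; cong; subst)
open import Relation.Nullary using (¬_; Dec; yes; no)
open import Relation.Nullary.Decidable using (True; toWitness; ¬?; _→-dec_)

at-map : ∀ {X Y : Set} (f : X → Y) (l : List X) i → at (map f l) i ≡ Maybe.map f (at l i)
at-map f []      i       = refl
at-map f (x ∷ l) zero    = refl
at-map f (x ∷ l) (suc i) = at-map f l i

lookup-injective : ∀ {X : Set} {xs : List X} → Unique xs → Injective _≡_ _≡_ (lookup xs)
lookup-injective {xs = _ ∷ _} _          {Fin.zero}  {Fin.zero}  _  = refl
lookup-injective {xs = _ ∷ _} (x∉xs ∷ _) {Fin.zero}  {Fin.suc j} eq =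
  ⊥-elim (All.lookup x∉xs (∈-lookup j) eq)
lookup-injective {xs = _ ∷ _} (x∉xs ∷ _) {Fin.suc i} {Fin.zero}  eq =
  ⊥-elim (All.lookup x∉xs (∈-lookup i) (sym eq))
lookup-injective {xs = _ ∷ _} (_ ∷ u)    {Fin.suc i} {Fin.suc j} eq = cong Fin.suc (lookup-injective u eq)

module _ {X : Set} (_≟_ : DecidableEquality X) where
  open DecMembership _≟_ using (_∈?_)

  Occupies : List X → Order X → X → PeakPit → Set
  Occupies T o x k = at (restrict _≟_ T o) (ppIndex k) ≡ just x

  restrict-idem : ∀ T o → restrict _≟_ T (restrict _≟_ T o) ≡ restrict _≟_ T o
  restrict-idem T = filter-idem (_∈? T)

  module _ {D : Domain X} {T : List X} {x : X} {k : PeakPit} where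

    never-Restr⁻ : Never _≟_ (Restr _≟_ T D) T x k → Never _≟_ D T x k
    never-Restr⁻ never o Do occ =
      never (restrict _≟_ T o) (o , Do , refl)
        (subst (λ l → at l (ppIndex k) ≡ just x) (sym (restrict-idem T o)) occ)

    never-Restr⁺ : Never _≟_ D T x k → Never _≟_ (Restr _≟_ T D) T x k
    never-Restr⁺ never _ (o , Do , refl) occ =
      never o Do (subst (λ l → at l (ppIndex k) ≡ just x) (restrict-idem T o) occ)

module _ {X Y : Set} (_≟ˣ_ : DecidableEquality X) (_≟ʸ_ : DecidableEquality Y)
         {e : Y → X} (e-injective : Injective _≡_ _≡_ e) where
  open DecMembership _≟ˣ_ using () renaming (_∈?_ to _∈ˣ?_)
  open DecMembership _≟ʸ_ using () renaming (_∈?_ to _∈ʸ?_)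

  ∈-map-injective : ∀ {y T} → e y ∈ map e T → y ∈ T
  ∈-map-injective e[y]∈ with ∈-map⁻ e e[y]∈
  ... | y′ , y′∈T , eq = subst (_∈ _) (sym (e-injective eq)) y′∈T

  restrict-map : ∀ T o → restrict _≟ˣ_ (map e T) (map e o) ≡ map e (restrict _≟ʸ_ T o)
  restrict-map T []      = refl
  restrict-map T (y ∷ o) with y ∈ʸ? T
  ... | yes y∈T = trans (filter-accept (_∈ˣ? map e T) (∈-map⁺ e y∈T)) (cong (e y ∷_) (restrict-map T o))
  ... | no  y∉T = trans (filter-reject (_∈ˣ? map e T) (y∉T ∘ ∈-map-injective)) (restrict-map T o)

  at-restrict-map : ∀ T o i →
    at (restrict _≟ˣ_ (map e T) (map e o)) i ≡ Maybe.map e (at (restrict _≟ʸ_ T o) i)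
  at-restrict-map T o i = trans (cong (λ l → at l i) (restrict-map T o)) (at-map e (restrict _≟ʸ_ T o) i)

  module _ {T : List Y} {o : Order Y} {y : Y} {k : PeakPit} where

    occupies-map⁺ : Occupies _≟ʸ_ T o y k → Occupies _≟ˣ_ (map e T) (map e o) (e y) k
    occupies-map⁺ occ = trans (at-restrict-map T o (ppIndex k)) (cong (Maybe.map e) occ)

    occupies-map⁻ : Occupies _≟ˣ_ (map e T) (map e o) (e y) k → Occupies _≟ʸ_ T o y k
    occupies-map⁻ occ = Maybe.map-injective e-injective (trans (sym (at-restrict-map T o (ppIndex k))) occ)

  occupies⇒¬Never : ∀ {U : Domain X} {k} o T y →
    U (map e o) → Occupies _≟ʸ_ T o y k → ¬ Never _≟ˣ_ U (map e T) (e y) k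
  occupies⇒¬Never o T y Uo occ never = never (map e o) Uo (occupies-map⁺ {T} {o} {y} occ)

module _ where
  open DecMembership (Fin._≟_ {4}) using (_∈?_)

  -- The implicit proof is found by evaluating the check on all 4⁴ lists of length 4.
  every-ordering : {P : Order (Fin 4) → Set} (P? : ∀ o → Dec (P o)) →
    {True (all? λ c₁ → all? λ c₂ → all? λ c₃ → all? λ c₄ →
             let o = c₁ ∷ c₂ ∷ c₃ ∷ c₄ ∷ [] in all? (_∈? o) →-dec P? o)} →
    ∀ o → allFin 4 ↭ o → P o
  every-ordering {P} P? {check} o ρ = quadruple o (↭-length ρ) (λ c → ∈-resp-↭ ρ (∈-allFin c))
    where
      quadruple : ∀ o → 4 ≡ length o → (∀ c → c ∈ o) → P o
      quadruple (c₁ ∷ c₂ ∷ c₃ ∷ c₄ ∷ []) _ covers = toWitness check c₁ c₂ c₃ c₄ covers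
      quadruple []                              ()
      quadruple (_ ∷ [])                        ()
      quadruple (_ ∷ _ ∷ [])                    ()
      quadruple (_ ∷ _ ∷ _ ∷ [])                ()
      quadruple (_ ∷ _ ∷ _ ∷ _ ∷ _ ∷ _)         ()

-- Fin 4 stands for {a, b, v, z}: A, B, V, Z are the indices of a, b, v, z in a ∷ b ∷ v ∷ z ∷ [].
A B V Z : Fin 4
A = # 0
B = # 1
V = # 2
Z = # 3

ABV ABZ BVZ ZBV : List (Fin 4)
ABV = A ∷ B ∷ V ∷ []
ABZ = A ∷ B ∷ Z ∷ []
BVZ = B ∷ V ∷ Z ∷ []
ZBV = Z ∷ B ∷ V ∷ []

Occupiesᶠ : List (Fin 4) → Order (Fin 4) → Fin 4 → PeakPit → Set
Occupiesᶠ = Occupies Fin._≟_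

occupiesᶠ? : ∀ T o c k → Dec (Occupiesᶠ T o c k)
occupiesᶠ? T o c k = Maybe.≡-dec Fin._≟_ _ _

restrictᶠ : List (Fin 4) → Order (Fin 4) → Order (Fin 4)
restrictᶠ = restrict Fin._≟_

-- b is above a and v, and not on top of {a, b, z}, so z is above b.
b-top-in-abv⇒zbv : ∀ o → allFin 4 ↭ o →
  Occupiesᶠ ABV o B top → ¬ Occupiesᶠ ABZ o B top → restrictᶠ BVZ o ≡ ZBV
b-top-in-abv⇒zbv = every-ordering λ o →
  occupiesᶠ? ABV o B top →-dec ¬? (occupiesᶠ? ABZ o B top) →-dec List.≡-dec Fin._≟_ (restrictᶠ BVZ o) ZBV

-- a and z are above b, and b is not at the bottom of {a, b, v}, so v is below b.
b-bottom-in-abz⇒zbv : ∀ o → allFin 4 ↭ o →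
  Occupiesᶠ ABZ o B bottom → ¬ Occupiesᶠ ABV o B bottom → restrictᶠ BVZ o ≡ ZBV
b-bottom-in-abz⇒zbv = every-ordering λ o →
  occupiesᶠ? ABZ o B bottom →-dec ¬? (occupiesᶠ? ABV o B bottom) →-dec List.≡-dec Fin._≟_ (restrictᶠ BVZ o) ZBV

module _ {X : Set} where

  data AlikeTriple {p q r : X} : Order X → X → X → Set where
    swap₁₂ : AlikeTriple (q ∷ p ∷ r ∷ []) p q
    swap₂₃ : AlikeTriple (p ∷ r ∷ q ∷ []) q r

  alike-triple : ∀ {p q r : X} {o x y} → Alike (p ∷ q ∷ r ∷ []) o x y → AlikeTriple {p} {q} {r} o x y
  alike-triple ([]                 , _ , refl , refl) = swap₁₂
  alike-triple (_ ∷ []             , _ , refl , refl) = swap₂₃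
  alike-triple (_ ∷ _ ∷ []         , _ , ()   , _)
  alike-triple (_ ∷ _ ∷ _ ∷ []     , _ , ()   , _)
  alike-triple (_ ∷ _ ∷ _ ∷ _ ∷ _  , _ , ()   , _)

  upper-first lower-first : X → X → X → List (Order X)
  upper-first p q r =
    (p ∷ q ∷ r ∷ []) ∷ (q ∷ p ∷ r ∷ []) ∷ (q ∷ r ∷ p ∷ []) ∷ (r ∷ q ∷ p ∷ []) ∷ []
  lower-first p q r =
    (p ∷ q ∷ r ∷ []) ∷ (p ∷ r ∷ q ∷ []) ∷ (r ∷ p ∷ q ∷ []) ∷ (r ∷ q ∷ p ∷ []) ∷ []

  lower-first-path : ∀ p q r →
    PathIn (p ∷ q ∷ r ∷ []) (p ∷ q ∷ r ∷ []) (r ∷ q ∷ p ∷ []) (lower-first p q r)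
  lower-first-path p q r = (_ , path) , linear , refl , refl
    where
      path : AlikePath (lower-first p q r) ((q , r) ∷ (p , r) ∷ (p , q) ∷ [])
      path = step (p ∷ [] , [] , refl , refl) (step ([] , q ∷ [] , refl , refl)
               (step (r ∷ [] , [] , refl , refl) (single _)))
      prq↭pqr : (p ∷ r ∷ q ∷ []) ↭ (p ∷ q ∷ r ∷ [])
      prq↭pqr = prep p (swap r q ↭-refl)
      linear : ∀ o → o ∈ lower-first p q r → IsLinOrd (p ∷ q ∷ r ∷ []) o
      linear _ (here refl)                         = ↭-refl
      linear _ (there (here refl))                 = prq↭pqr
      linear _ (there (there (here refl)))         = ↭-trans (swap r p ↭-refl) prq↭pqr
      linear _ (there (there (there (here refl)))) = ↭-reverse (p ∷ q ∷ r ∷ [])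

  module _ {p q r : X} (p≢q : p ≢ q) (p≢r : p ≢ r) (q≢r : q ≢ r) where

    private
      first : ∀ {x y : X} {xs ys} → just (x ∷ xs) ≡ just (y ∷ ys) → x ≡ y
      first = ∷-injectiveˡ ∘ just-injective

      second : ∀ {x x′ y y′ : X} {xs ys} → just (x ∷ y ∷ xs) ≡ just (x′ ∷ y′ ∷ ys) → y ≡ y′
      second = ∷-injectiveˡ ∘ ∷-injectiveʳ ∘ just-injective

    reversal-paths : ∀ {G ps} → AlikePath G ps →
      head G ≡ just (p ∷ q ∷ r ∷ []) → last G ≡ just (r ∷ q ∷ p ∷ []) → length G ≤ 4 →
      (G ≡ upper-first p q r × ps ≡ (p , q) ∷ (p , r) ∷ (q , r) ∷ []) ⊎
      (G ≡ lower-first p q r × ps ≡ (q , r) ∷ (p , r) ∷ (p , q) ∷ [])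
    reversal-paths (single _) refl end _ = ⊥-elim (p≢r (first end))
    reversal-paths (step s₁ (single _)) refl end _ with alike-triple s₁
    ... | swap₁₂ = ⊥-elim (q≢r (first end))
    ... | swap₂₃ = ⊥-elim (p≢r (first end))
    reversal-paths (step s₁ (step s₂ (single _))) refl end _ with alike-triple s₁
    ... | swap₁₂ with alike-triple s₂
    ...   | swap₁₂ = ⊥-elim (p≢r (first end))
    ...   | swap₂₃ = ⊥-elim (q≢r (first end))
    reversal-paths (step s₁ (step s₂ (single _))) refl end _ | swap₂₃ with alike-triple s₂
    ...   | swap₁₂ = ⊥-elim (p≢q (second end))
    ...   | swap₂₃ = ⊥-elim (p≢r (first end))
    reversal-paths (step s₁ (step s₂ (step s₃ (single _)))) refl end _ with alike-triple s₁
    ... | swap₁₂ with alike-triple s₂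
    ...   | swap₁₂ with alike-triple s₃
    ...     | swap₁₂ = ⊥-elim (q≢r (first end))
    ...     | swap₂₃ = ⊥-elim (p≢r (first end))
    reversal-paths (step s₁ (step s₂ (step s₃ (single _)))) refl end _ | swap₁₂ | swap₂₃ with alike-triple s₃
    ...     | swap₁₂ = inj₁ (refl , refl)
    ...     | swap₂₃ = ⊥-elim (q≢r (first end))
    reversal-paths (step s₁ (step s₂ (step s₃ (single _)))) refl end _ | swap₂₃ with alike-triple s₂
    ...   | swap₁₂ with alike-triple s₃
    ...     | swap₁₂ = ⊥-elim (p≢r (first end))
    ...     | swap₂₃ = inj₂ (refl , refl)
    reversal-paths (step s₁ (step s₂ (step s₃ (single _)))) refl end _ | swap₂₃ | swap₂₃ with alike-triple s₃
    ...     | swap₁₂ = ⊥-elim (q≢r (first end))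
    ...     | swap₂₃ = ⊥-elim (p≢r (first end))
    reversal-paths (step _ (step _ (step _ (step _ _)))) _ _ (s≤s (s≤s (s≤s (s≤s ()))))

module FourAlternatives
         {X : Set} (_≟_ : DecidableEquality X) (a b v z : X)
         (a≢b : a ≢ b) (a≢v : a ≢ v) (a≢z : a ≢ z) (b≢v : b ≢ v) (b≢z : b ≢ z) (v≢z : v ≢ z)
         (D : Domain X) (linear : (o : Order X) → D o → IsLinOrd (a ∷ b ∷ v ∷ z ∷ []) o)
         (peak-pit : PeakPitCD _≟_ (a ∷ b ∷ v ∷ z ∷ []) D)
         (abvz∈D : D (a ∷ b ∷ v ∷ z ∷ [])) (vzba∈D : D (v ∷ z ∷ b ∷ a ∷ []))
         (Np-abz : NpIsSingleton _≟_ (Restr _≟_ (a ∷ b ∷ z ∷ []) D) (a ∷ b ∷ z ∷ []) b top) where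

  private
    e : Fin 4 → X
    e = lookup (a ∷ b ∷ v ∷ z ∷ [])

    e-injective : Injective _≡_ _≡_ e
    e-injective = lookup-injective ((a≢b ∷ a≢v ∷ a≢z ∷ []) ∷ (b≢v ∷ b≢z ∷ []) ∷ (v≢z ∷ []) ∷ [] ∷ [])

    refute : ∀ {U : Domain X} {k} o T y → U (map e o) → Occupiesᶠ T o y k → ¬ Never _≟_ U (map e T) (e y) k
    refute = occupies⇒¬Never _≟_ Fin._≟_ e-injective

    ordering : ∀ {o} → D o → ∃ λ o′ → o ≡ map e o′ × allFin 4 ↭ o′
    ordering {o} Do = ↭-map-inv e {allFin 4} (↭-sym (linear o Do))

    ABVZ VZBA : Order (Fin 4)
    ABVZ = A ∷ B ∷ V ∷ Z ∷ []
    VZBA = V ∷ Z ∷ B ∷ A ∷ []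

  never-zbv : ∀ o → D (map e o) → restrictᶠ BVZ o ≢ ZBV
  never-zbv o Do zbv
    with peak-pit b v z (there (here refl)) (there (there (here refl))) (there (there (there (here refl))))
                  b≢v b≢z v≢z
  ... | _ , top    , here refl                 , never = refute ABVZ BVZ B abvz∈D refl never
  ... | _ , bottom , here refl                 , never = refute VZBA BVZ B vzba∈D refl never
  ... | _ , top    , there (here refl)         , never = refute VZBA BVZ V vzba∈D refl never
  ... | _ , bottom , there (here refl)         , never = refute o BVZ V Do (cong (λ l → at l 2) zbv) never
  ... | _ , top    , there (there (here refl)) , never = refute o BVZ Z Do (cong (λ l → at l 0) zbv) never
  ... | _ , bottom , there (there (here refl)) , never = refute ABVZ BVZ Z abvz∈D refl never

  never-via-zbv : ∀ {T T′ c c′ k k′} →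
    (∀ o → allFin 4 ↭ o → Occupiesᶠ T o c k → ¬ Occupiesᶠ T′ o c′ k′ → restrictᶠ BVZ o ≡ ZBV) →
    Never _≟_ D (map e T′) (e c′) k′ → Never _≟_ D (map e T) (e c) k
  never-via-zbv {T} {T′} {c} {c′} forces-zbv never′ _ Do occ with o , refl , ρ ← ordering Do =
    never-zbv o Do (forces-zbv o ρ (occupies-map⁻ _≟_ Fin._≟_ e-injective {T} {o} {c} occ)
                                   (never′ (map e o) Do ∘ occupies-map⁺ _≟_ Fin._≟_ e-injective {T′} {o} {c′}))

  b-never-top : Never _≟_ D (a ∷ b ∷ v ∷ []) b top
  b-never-top = never-via-zbv b-top-in-abv⇒zbv (never-Restr⁻ _≟_ (proj₁ Np-abz))

  b-not-never-bottom : ¬ Never _≟_ D (a ∷ b ∷ v ∷ []) b bottom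
  b-not-never-bottom never
    with () ← proj₂ (proj₂ Np-abz b bottom (there (here refl))
                      (never-Restr⁺ _≟_ (never-via-zbv b-bottom-in-abz⇒zbv never)))

  only-b-never-top : ∀ x k → x ∈ (a ∷ b ∷ v ∷ []) → Never _≟_ D (a ∷ b ∷ v ∷ []) x k → x ≡ b × k ≡ top
  only-b-never-top _ top    (here refl)                 never = ⊥-elim (refute ABVZ ABV A abvz∈D refl never)
  only-b-never-top _ bottom (here refl)                 never = ⊥-elim (refute VZBA ABV A vzba∈D refl never)
  only-b-never-top _ top    (there (here refl))         _     = refl , refl
  only-b-never-top _ bottom (there (here refl))         never = ⊥-elim (b-not-never-bottom never)
  only-b-never-top _ top    (there (there (here refl))) never = ⊥-elim (refute VZBA ABV V vzba∈D refl never)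
  only-b-never-top _ bottom (there (there (here refl))) never = ⊥-elim (refute ABVZ ABV V abvz∈D refl never)

  Np-abv : NpIsSingleton _≟_ (Restr _≟_ (a ∷ b ∷ v ∷ []) D) (a ∷ b ∷ v ∷ []) b top
  Np-abv = never-Restr⁺ _≟_ b-never-top , λ x k x∈ → only-b-never-top x k x∈ ∘ never-Restr⁻ _≟_

  upper-first-not-peak-pit :
    ¬ PeakPitCD _≟_ (a ∷ b ∷ v ∷ []) (λ o → Restr _≟_ (a ∷ b ∷ v ∷ []) D o ⊎ o ∈ upper-first a b v)
  upper-first-not-peak-pit peak-pit′
    with peak-pit′ a b v (here refl) (there (here refl)) (there (there (here refl))) a≢b a≢v b≢v
  ... | _ , top    , here refl                 , never = refute ABV ABV A (inj₂ (here refl)) refl never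
  ... | _ , bottom , here refl                 , never =
    refute (B ∷ V ∷ A ∷ []) ABV A (inj₂ (there (there (here refl)))) refl never
  ... | _ , top    , there (here refl)         , never =
    refute (B ∷ A ∷ V ∷ []) ABV B (inj₂ (there (here refl))) refl never
  ... | _ , bottom , there (here refl)         , never = b-not-never-bottom (never-Restr⁻ _≟_ (λ o → never o ∘ inj₁))
  ... | _ , top    , there (there (here refl)) , never =
    refute (V ∷ B ∷ A ∷ []) ABV V (inj₂ (there (there (there (here refl))))) refl never
  ... | _ , bottom , there (there (here refl)) , never = refute ABV ABV V (inj₂ (here refl)) refl never

  geodesic-switches : ∀ G → Geodesic (a ∷ b ∷ v ∷ []) (a ∷ b ∷ v ∷ []) (v ∷ b ∷ a ∷ []) G →
    PeakPitCD _≟_ (a ∷ b ∷ v ∷ []) (λ o → Restr _≟_ (a ∷ b ∷ v ∷ []) D o ⊎ o ∈ G) →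
    ∀ ps → AlikePath G ps → ps ≡ (b , v) ∷ (a , v) ∷ (a , b) ∷ []
  geodesic-switches G ((_ , _ , start , end) , shortest) peak-pit′ ps path
    with reversal-paths a≢b a≢v b≢v path start end (shortest _ (lower-first-path a b v))
  ... | inj₁ (refl , _)     = ⊥-elim (upper-first-not-peak-pit peak-pit′)
  ... | inj₂ (_ , switches) = switches

lemma14 : {X : Set} (_≟_ : DecidableEquality X) (a b v z : X) →
    a ≢ b → a ≢ v → a ≢ z → b ≢ v → b ≢ z → v ≢ z →
    (D : Domain X) →
    ((o : Order X) → D o → IsLinOrd (a ∷ b ∷ v ∷ z ∷ []) o) →
    PeakPitCD _≟_ (a ∷ b ∷ v ∷ z ∷ []) D →
    D (a ∷ b ∷ v ∷ z ∷ []) →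
    D (v ∷ z ∷ b ∷ a ∷ []) →
    NpIsSingleton _≟_ (Restr _≟_ (a ∷ b ∷ z ∷ []) D) (a ∷ b ∷ z ∷ []) b top →
    NpIsSingleton _≟_ (Restr _≟_ (a ∷ b ∷ v ∷ []) D) (a ∷ b ∷ v ∷ []) b top
    × ((G : List (Order X)) →
       Geodesic (a ∷ b ∷ v ∷ []) (a ∷ b ∷ v ∷ []) (v ∷ b ∷ a ∷ []) G →
       PeakPitCD _≟_ (a ∷ b ∷ v ∷ [])
         (λ o → Restr _≟_ (a ∷ b ∷ v ∷ []) D o ⊎ o ∈ G) →
       (ps : List (X × X)) → AlikePath G ps →
       ps ≡ ((b , v) ∷ (a , v) ∷ (a , b) ∷ []))
lemma14 _≟_ a b v z a≢b a≢v a≢z b≢v b≢z v≢z D linear peak-pit abvz∈D vzba∈D Np-abz =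
  Np-abv , geodesic-switches
  where open FourAlternatives _≟_ a b v z a≢b a≢v a≢z b≢v b≢z v≢z D linear peak-pit abvz∈D vzba∈D Np-abz
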